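{- Let $\delta^*$ be a minimal feasible integral solution of the covering formulation [COV] which is not a feasible solution of the formulation [FAS]. Then the set $T$ of basic triples of $\delta^*$ is nonempty.
   Context: $V$ is a finite set and $P$ a partial order on $V$ (reflexive, antisymmetric, transitive, viewed as a set of ordered pairs, so $(x,x)\in P$ for all $x$). $\mathrm{inc}(P)=\{(x,y)\in V\times V:(x,y)\notin P,\ (y,x)\notin P\}$. A solution is a vector $\delta=(\delta_{(i,j)})$ indexed by ordered pairs of distinct elements of $V$, where only entries on pairs of $\mathrm{inc}(P)$ are free; by convention, for $i\neq j$, $\delta_{(i,j)}=1$ if $(i,j)\in P$ and $\delta_{(i,j)}=0$ if $(j,i)\in P$. Formulation [FAS]: $\delta_{(i,j)}\in\{0,1\}$ for all distinct $i,j$; $\delta_{(i,j)}+\delta_{(j,i)}=1$ for all distinct $i,j$; $\delta_{(i,j)}+\delta_{(j,k)}+\delta_{(k,i)}\ge1$ for all distinct $i,j,k$. Covering formulation [COV]: $\delta_{(i,j)}\in\{0,1\}$ for $(i,j)\in\mathrm{inc}(P)$, subject to (C2) $\delta_{(x_1,y_1)}+\delta_{(x_2,y_2)}\ge1$ for all $x_1,y_1,x_2,y_2\in V$ with $x_1\ne y_1$, $x_2\ne y_2$, $(x_2,y_1),(x_1,y_2)\in P$; and (C3) $\delta_{(x_1,y_1)}+\delta_{(x_2,y_2)}+\delta_{(x_3,y_3)}\ge1$ for all $x_1,\dots,y_3\in V$ with $x_i\ne y_i$, $(x_2,y_1),(x_3,y_2),(x_1,y_3)\in P$. A feasible $0/1$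 solution $\delta^*$ of [COV] is minimal if for every $(i,j)\in\mathrm{inc}(P)$ with $\delta^*_{(i,j)}=1$, changing it to $0$ yields an infeasible solution of [COV]. A triple $(a,c,b)$ of distinct elements of $V$ is a basic triple (of $\delta^*$) if $\delta^*_{(a,c)}=\delta^*_{(c,b)}=\delta^*_{(a,b)}=\delta^*_{(b,a)}=1$ and $\delta^*_{(c,a)}=\delta^*_{(b,c)}=0$; $T$ denotes the set of all basic triples. -}

module Defs where

open import Data.Nat using (ℕ; _+_; _≥_)
open import Data.Fin using (Fin; _≟_)
open import Data.Product using (_×_; Σ; ∃; _,_)
open import Data.Sum using (_⊎_)
open import Data.Bool using (if_then_else_; _∧_)
open import Relation.Nullary using (¬_; does)
open import Relation.Binary.PropositionalEquality using (_≡_; _≢_)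

inc : {n : ℕ} → (Fin n → Fin n → Set) → Fin n → Fin n → Set
inc P x y = ¬ P x y × ¬ P y x

-- A candidate vector δ indexed by ordered pairs (diagonal entries are
-- never used).  Values are natural numbers; integrality is imposed below.
Vector : ℕ → Set
Vector n = Fin n → Fin n → ℕ

RespectsP : {n : ℕ} → (Fin n → Fin n → Set) → Vector n → Set
RespectsP P δ =
  (∀ i j → i ≢ j → P i j → δ i j ≡ 1) × (∀ i j → i ≢ j → P j i → δ i j ≡ 0)

BinaryOnInc : {n : ℕ} → (Fin n → Fin n → Set) → Vector n → Set
BinaryOnInc P δ = ∀ i j → inc P i j → (δ i j ≡ 0 ⊎ δ i j ≡ 1)

C2 : {n : ℕ} → (Fin n → Fin n → Set) → Vector n → Set
C2 P δ = ∀ x₁ y₁ x₂ y₂ → x₁ ≢ y₁ → x₂ ≢ y₂ → P x₂ y₁ → P x₁ y₂ →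
  δ x₁ y₁ + δ x₂ y₂ ≥ 1

C3 : {n : ℕ} → (Fin n → Fin n → Set) → Vector n → Set
C3 P δ = ∀ x₁ y₁ x₂ y₂ x₃ y₃ → x₁ ≢ y₁ → x₂ ≢ y₂ → x₃ ≢ y₃ →
  P x₂ y₁ → P x₃ y₂ → P x₁ y₃ →
  δ x₁ y₁ + δ x₂ y₂ + δ x₃ y₃ ≥ 1

COVFeasible : {n : ℕ} → (Fin n → Fin n → Set) → Vector n → Set
COVFeasible P δ = RespectsP P δ × BinaryOnInc P δ × C2 P δ × C3 P δ

FASFeasible : {n : ℕ} → Vector n → Set
FASFeasible {n} δ =
    (∀ i j → i ≢ j → (δ i j ≡ 0 ⊎ δ i j ≡ 1))
  × (∀ i j → i ≢ j → δ i j + δ j i ≡ 1)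
  × (∀ i j k → i ≢ j → j ≢ k → i ≢ k → δ i j + δ j k + δ k i ≥ 1)

setZero : {n : ℕ} → Vector n → Fin n → Fin n → Vector n
setZero δ i j a b = if does (a ≟ i) ∧ does (b ≟ j) then 0 else δ a b

MinimalCOV : {n : ℕ} → (Fin n → Fin n → Set) → Vector n → Set
MinimalCOV P δ = COVFeasible P δ ×
  (∀ i j → inc P i j → δ i j ≡ 1 → ¬ COVFeasible P (setZero δ i j))

BasicTriple : {n : ℕ} → Vector n → Fin n → Fin n → Fin n → Set
BasicTriple δ a c b =
  a ≢ c × c ≢ b × a ≢ b ×
  δ a c ≡ 1 × δ c b ≡ 1 × δ a b ≡ 1 × δ b a ≡ 1 × δ c a ≡ 0 × δ b c ≡ 0

TNonempty : {n : ℕ} → Vector n → Set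
TNonempty δ = Σ _ λ a → Σ _ λ c → Σ _ λ b → BasicTriple δ a c b

-- Write x ≺ y when x ≢ y and δ(y,x) = 0, and call {a,b} a tie when
-- δ(a,b) = δ(b,a) = 1; a basic triple is a tie (a,b) with a ≺ c ≺ b.
-- Constraint (C2) says that x P y ≺ z P w forces δ(x,w) = 1, so such a chain
-- ends either in x ≺ w or in a tie {x,w}. Using this repeatedly, a tie (a,b)
-- without basic triples admits no chain a P u ≺ v P b and no chain
-- a P u ≺ v P w ≺ z P b; these chains are exactly the (C2) and (C3)
-- constraints that rely on δ(a,b), so δ(a,b) could be lowered to 0,
-- against minimality. Without ties, [COV] is [FAS]: (C2) with x₂ = y₁ and
-- x₁ = y₂ gives δ(i,j) + δ(j,i) ≥ 1, and (C3) gives the triangle inequalities.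
module Submission where

open import Defs
open import Data.Nat using (ℕ; zero; suc; _+_; _≥_; s≤s; z≤n)
import Data.Nat as ℕ
open import Data.Nat.Properties using (0≢1+n; n≮0)
open import Data.Fin using (Fin; _≟_)
open import Data.Fin.Properties using (any?)
open import Data.Product using (_×_; _,_; proj₁; proj₂)
open import Data.Sum using (_⊎_; inj₁; inj₂)
open import Data.Empty using (⊥; ⊥-elim)
open import Relation.Nullary using (¬_; Dec; yes; no)
open import Relation.Nullary.Decidable using (¬?; _×-dec_; decidable-stable)
open import Relation.Binary.PropositionalEquality
  using (_≡_; _≢_; refl; sym; trans; subst₂; ≢-sym)
open import Relation.Binary.Definitions using (Decidable)
open import Relation.Binary.Structures using (IsPartialOrder)

sum₂≥1 : ∀ p q → (p ≡ 0 → q ≡ 0 → ⊥) → p + q ≥ 1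
sum₂≥1 zero    zero    not-both-0 = ⊥-elim (not-both-0 refl refl)
sum₂≥1 zero    (suc q) _          = s≤s z≤n
sum₂≥1 (suc p) q       _          = s≤s z≤n

sum₃≥1 : ∀ p q r → (p ≡ 0 → q ≡ 0 → r ≡ 0 → ⊥) → p + q + r ≥ 1
sum₃≥1 zero    zero    zero    not-all-0 = ⊥-elim (not-all-0 refl refl refl)
sum₃≥1 zero    zero    (suc r) _         = s≤s z≤n
sum₃≥1 zero    (suc q) r       _         = s≤s z≤n
sum₃≥1 (suc p) q       r       _         = s≤s z≤n

TNonempty? : ∀ {n} (δ : Vector n) → Dec (TNonempty δ)
TNonempty? δ = any? λ a → any? λ c → any? λ b →
  ¬? (a ≟ c) ×-dec ¬? (c ≟ b) ×-dec ¬? (a ≟ b) ×-dec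
  (δ a c ℕ.≟ 1) ×-dec (δ c b ℕ.≟ 1) ×-dec (δ a b ℕ.≟ 1) ×-dec (δ b a ℕ.≟ 1) ×-dec
  (δ c a ℕ.≟ 0) ×-dec (δ b c ℕ.≟ 0)

module Covering {n : ℕ} {P : Fin n → Fin n → Set}
  (po : IsPartialOrder _≡_ P) (dec : Decidable P)
  {δ : Vector n} (feasible : COVFeasible P δ) where

  open IsPartialOrder po using () renaming (refl to P-refl; trans to P-trans)

  respects₁ : ∀ i j → i ≢ j → P i j → δ i j ≡ 1
  respects₁ = proj₁ (proj₁ feasible)

  respects₀ : ∀ i j → i ≢ j → P j i → δ i j ≡ 0
  respects₀ = proj₂ (proj₁ feasible)

  binary-inc : BinaryOnInc P δ
  binary-inc = proj₁ (proj₂ feasible)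

  c2 : C2 P δ
  c2 = proj₁ (proj₂ (proj₂ feasible))

  c3 : C3 P δ
  c3 = proj₂ (proj₂ (proj₂ feasible))

  δ-binary : ∀ {i j} → i ≢ j → δ i j ≡ 0 ⊎ δ i j ≡ 1
  δ-binary {i} {j} i≢j with dec i j | dec j i
  ... | yes Pij | _       = inj₂ (respects₁ i j i≢j Pij)
  ... | no _    | yes Pji = inj₁ (respects₀ i j i≢j Pji)
  ... | no ¬Pij | no ¬Pji = binary-inc i j (¬Pij , ¬Pji)

  _≺_ : Fin n → Fin n → Set
  x ≺ y = x ≢ y × δ y x ≡ 0

  Tie : Fin n → Fin n → Set
  Tie a b = a ≢ b × δ a b ≡ 1 × δ b a ≡ 1

  Tie-sym : ∀ {a b} → Tie a b → Tie b a
  Tie-sym (a≢b , δab≡1 , δba≡1) = ≢-sym a≢b , δba≡1 , δab≡1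

  Tie⇒¬≺ : ∀ {a b} → Tie a b → ¬ a ≺ b
  Tie⇒¬≺ (_ , _ , δba≡1) (_ , δba≡0) = 0≢1+n (trans (sym δba≡0) δba≡1)

  P⇒≺ : ∀ {x y} → x ≢ y → P x y → x ≺ y
  P⇒≺ {x} {y} x≢y Pxy = x≢y , respects₀ y x (≢-sym x≢y) Pxy

  P⇒≡⊎≺ : ∀ {x y} → P x y → x ≡ y ⊎ x ≺ y
  P⇒≡⊎≺ {x} {y} Pxy with x ≟ y
  ... | yes x≡y = inj₁ x≡y
  ... | no x≢y  = inj₂ (P⇒≺ x≢y Pxy)

  ≺⇒¬P⁻¹ : ∀ {x y} → x ≺ y → ¬ P y x
  ≺⇒¬P⁻¹ {x} {y} (x≢y , δyx≡0) Pyx =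
    0≢1+n (trans (sym δyx≡0) (respects₁ y x (≢-sym x≢y) Pyx))

  ≺-or-δ≡1 : ∀ {x y} → x ≢ y → x ≺ y ⊎ δ y x ≡ 1
  ≺-or-δ≡1 x≢y with δ-binary (≢-sym x≢y)
  ... | inj₁ δyx≡0 = inj₁ (x≢y , δyx≡0)
  ... | inj₂ δyx≡1 = inj₂ δyx≡1

  P≺P⇒≢ : ∀ {x y z w} → P x y → y ≺ z → P z w → x ≢ w
  P≺P⇒≢ Pxy y≺z Pzx refl = ≺⇒¬P⁻¹ y≺z (P-trans Pzx Pxy)

  P≺P⇒δ≡1 : ∀ {x y z w} → P x y → y ≺ z → P z w → δ x w ≡ 1
  P≺P⇒δ≡1 {x} {y} {z} {w} Pxy y≺z@(y≢z , δzy≡0) Pzw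
    with x≢w ← P≺P⇒≢ Pxy y≺z Pzw
    with δ-binary x≢w
  ... | inj₂ δxw≡1 = δxw≡1
  ... | inj₁ δxw≡0 =
    ⊥-elim (n≮0 (subst₂ (λ p q → p + q ≥ 1) δzy≡0 δxw≡0
      (c2 z y x w (≢-sym y≢z) x≢w Pxy Pzw)))

  ≺⇒δ≡1 : ∀ {x y} → x ≺ y → δ x y ≡ 1
  ≺⇒δ≡1 x≺y = P≺P⇒δ≡1 P-refl x≺y P-refl

  P≺P⇒≺⊎Tie : ∀ {x y z w} → P x y → y ≺ z → P z w → x ≺ w ⊎ Tie x w
  P≺P⇒≺⊎Tie Pxy y≺z Pzw
    with x≢w ← P≺P⇒≢ Pxy y≺z Pzw
    with ≺-or-δ≡1 x≢w
  ... | inj₁ x≺w   = inj₁ x≺w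
  ... | inj₂ δwx≡1 =
    inj₂ (x≢w , P≺P⇒δ≡1 Pxy y≺z Pzw , δwx≡1)

  Tie⇒inc : ∀ {a b} → Tie a b → inc P a b
  Tie⇒inc tie@(a≢b , _) =
    (λ Pab → Tie⇒¬≺ tie (P⇒≺ a≢b Pab)) ,
    (λ Pba → Tie⇒¬≺ (Tie-sym tie) (P⇒≺ (≢-sym a≢b) Pba))

  Tie⇒BasicTriple : ∀ {a b c} → Tie a b → a ≺ c → c ≺ b → BasicTriple δ a c b
  Tie⇒BasicTriple (a≢b , δab≡1 , δba≡1) a≺c@(a≢c , δca≡0) c≺b@(c≢b , δbc≡0) =
    a≢c , c≢b , a≢b , ≺⇒δ≡1 a≺c , ≺⇒δ≡1 c≺b , δab≡1 , δba≡1 , δca≡0 , δbc≡0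

  module Lowering {a b : Fin n} (a∥b : inc P a b)
    (¬P≺P   : ∀ {u v} → P a u → u ≺ v → P v b → ⊥)
    (¬P≺P≺P : ∀ {u v w z} → P a u → u ≺ v → P v w → w ≺ z → P z b → ⊥) where

    δ′ : Vector n
    δ′ = setZero δ a b

    δ′-cases : ∀ x y → (x ≡ a × y ≡ b) × δ′ x y ≡ 0 ⊎ δ′ x y ≡ δ x y
    δ′-cases x y with x ≟ a | y ≟ b
    ... | yes x≡a | yes y≡b = inj₁ ((x≡a , y≡b) , refl)
    ... | yes _   | no _    = inj₂ refl
    ... | no _    | _       = inj₂ refl

    ¬Pab : ¬ P a b
    ¬Pab = proj₁ a∥b

    respects : RespectsP P δ′
    respects = r₁ , r₀
      where
      r₁ : ∀ i j → i ≢ j → P i j → δ′ i j ≡ 1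
      r₁ i j i≢j Pij with δ′-cases i j
      ... | inj₁ ((refl , refl) , _) = ⊥-elim (¬Pab Pij)
      ... | inj₂ δ′≡δ = trans δ′≡δ (respects₁ i j i≢j Pij)
      r₀ : ∀ i j → i ≢ j → P j i → δ′ i j ≡ 0
      r₀ i j i≢j Pji with δ′-cases i j
      ... | inj₁ ((refl , refl) , _) = ⊥-elim (proj₂ a∥b Pji)
      ... | inj₂ δ′≡δ = trans δ′≡δ (respects₀ i j i≢j Pji)

    binary : BinaryOnInc P δ′
    binary i j i∥j with δ′-cases i j | binary-inc i j i∥j
    ... | inj₁ (_ , δ′≡0) | _         = inj₁ δ′≡0
    ... | inj₂ δ′≡δ       | inj₁ δ≡0 = inj₁ (trans δ′≡δ δ≡0)
    ... | inj₂ δ′≡δ       | inj₂ δ≡1 = inj₂ (trans δ′≡δ δ≡1)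

    c2′ : C2 P δ′
    c2′ x₁ y₁ x₂ y₂ n₁ n₂ P₂₁ P₁₂ with δ′-cases x₁ y₁ | δ′-cases x₂ y₂
    ... | inj₁ ((refl , refl) , _) | inj₁ ((refl , refl) , _) = ⊥-elim (¬Pab P₂₁)
    ... | inj₁ ((refl , refl) , e₁) | inj₂ e₂ rewrite e₁ | e₂ =
      sum₂≥1 0 _ λ _ δ₂≡0 → ¬P≺P P₁₂ (≢-sym n₂ , δ₂≡0) P₂₁
    ... | inj₂ e₁ | inj₁ ((refl , refl) , e₂) rewrite e₁ | e₂ =
      sum₂≥1 _ 0 λ δ₁≡0 _ → ¬P≺P P₂₁ (≢-sym n₁ , δ₁≡0) P₁₂
    ... | inj₂ e₁ | inj₂ e₂ rewrite e₁ | e₂ = c2 x₁ y₁ x₂ y₂ n₁ n₂ P₂₁ P₁₂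

    c3′ : C3 P δ′
    c3′ x₁ y₁ x₂ y₂ x₃ y₃ n₁ n₂ n₃ P₂₁ P₃₂ P₁₃
      with δ′-cases x₁ y₁ | δ′-cases x₂ y₂ | δ′-cases x₃ y₃
    ... | inj₁ ((refl , refl) , _) | inj₁ ((refl , refl) , _) | _ = ⊥-elim (¬Pab P₂₁)
    ... | _ | inj₁ ((refl , refl) , _) | inj₁ ((refl , refl) , _) = ⊥-elim (¬Pab P₃₂)
    ... | inj₁ ((refl , refl) , _) | _ | inj₁ ((refl , refl) , _) = ⊥-elim (¬Pab P₁₃)
    ... | inj₁ ((refl , refl) , e₁) | inj₂ e₂ | inj₂ e₃ rewrite e₁ | e₂ | e₃ =
      sum₃≥1 0 _ _ λ _ δ₂≡0 δ₃≡0 →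
        ¬P≺P≺P P₁₃ (≢-sym n₃ , δ₃≡0) P₃₂ (≢-sym n₂ , δ₂≡0) P₂₁
    ... | inj₂ e₁ | inj₁ ((refl , refl) , e₂) | inj₂ e₃ rewrite e₁ | e₂ | e₃ =
      sum₃≥1 _ 0 _ λ δ₁≡0 _ δ₃≡0 →
        ¬P≺P≺P P₂₁ (≢-sym n₁ , δ₁≡0) P₁₃ (≢-sym n₃ , δ₃≡0) P₃₂
    ... | inj₂ e₁ | inj₂ e₂ | inj₁ ((refl , refl) , e₃) rewrite e₁ | e₂ | e₃ =
      sum₃≥1 _ _ 0 λ δ₁≡0 δ₂≡0 _ →
        ¬P≺P≺P P₃₂ (≢-sym n₂ , δ₂≡0) P₂₁ (≢-sym n₁ , δ₁≡0) P₁₃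
    ... | inj₂ e₁ | inj₂ e₂ | inj₂ e₃ rewrite e₁ | e₂ | e₃ =
      c3 x₁ y₁ x₂ y₂ x₃ y₃ n₁ n₂ n₃ P₂₁ P₃₂ P₁₃

    setZero-feasible : COVFeasible P δ′
    setZero-feasible = respects , binary , c2′ , c3′

  module WithoutBasicTriples (¬T : ¬ TNonempty δ) where

    Tie⇒¬≺≺ : ∀ {a b c} → Tie a b → a ≺ c → c ≺ b → ⊥
    Tie⇒¬≺≺ {a} {b} {c} tie a≺c c≺b = ¬T (a , c , b , Tie⇒BasicTriple tie a≺c c≺b)

    Tie⇒¬≺P : ∀ {a b c} → Tie a b → a ≺ c → P c b → ⊥
    Tie⇒¬≺P tie a≺c Pcb with P⇒≡⊎≺ Pcb
    ... | inj₁ refl = Tie⇒¬≺ tie a≺c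
    ... | inj₂ c≺b  = Tie⇒¬≺≺ tie a≺c c≺b

    Tie⇒¬P≺ : ∀ {a b c} → Tie a b → P a c → c ≺ b → ⊥
    Tie⇒¬P≺ tie Pac c≺b with P⇒≡⊎≺ Pac
    ... | inj₁ refl = Tie⇒¬≺ tie c≺b
    ... | inj₂ a≺c  = Tie⇒¬≺≺ tie a≺c c≺b

    Tie⇒¬P≺P : ∀ {a b u v} → Tie a b → P a u → u ≺ v → P v b → ⊥
    Tie⇒¬P≺P tie Pau u≺v Pvb with P≺P⇒≺⊎Tie P-refl u≺v Pvb
    ... | inj₁ u≺b    = Tie⇒¬P≺ tie Pau u≺b
    ... | inj₂ tie-ub = Tie⇒¬≺P tie-ub u≺v Pvb

    Tie⇒¬≺P≺ : ∀ {a b v w} → Tie a b → a ≺ v → P v w → w ≺ b → ⊥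
    Tie⇒¬≺P≺ tie a≺v Pvw w≺b with P≺P⇒≺⊎Tie P-refl a≺v Pvw
    ... | inj₁ a≺w    = Tie⇒¬≺≺ tie a≺w w≺b
    ... | inj₂ tie-aw = Tie⇒¬≺P tie-aw a≺v Pvw

    Tie⇒¬P≺P≺P : ∀ {a b u v w z} →
      Tie a b → P a u → u ≺ v → P v w → w ≺ z → P z b → ⊥
    Tie⇒¬P≺P≺P tie Pau u≺v Pvw w≺z Pzb
      with P≺P⇒≺⊎Tie Pau u≺v P-refl | P≺P⇒≺⊎Tie P-refl w≺z Pzb
    ... | inj₂ tie-av | _           = Tie⇒¬P≺P tie-av Pau u≺v P-refl
    ... | _           | inj₂ tie-wb = Tie⇒¬P≺P tie-wb P-refl w≺z Pzb
    ... | inj₁ a≺v    | inj₁ w≺b    = Tie⇒¬≺P≺ tie a≺v Pvw w≺b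

    ¬Tie : (∀ i j → inc P i j → δ i j ≡ 1 → ¬ COVFeasible P (setZero δ i j)) →
      ∀ {a b} → ¬ Tie a b
    ¬Tie minimal {a} {b} tie@(_ , δab≡1 , _) =
      minimal a b a∥b δab≡1 (Lowering.setZero-feasible a∥b
        (Tie⇒¬P≺P tie) (Tie⇒¬P≺P≺P tie))
      where a∥b = Tie⇒inc tie

  δ-complementary : (∀ {a b} → ¬ Tie a b) → ∀ {i j} → i ≢ j → δ i j + δ j i ≡ 1
  δ-complementary ¬Tie i≢j with ≺-or-δ≡1 i≢j
  ... | inj₁ i≺j@(_ , δji≡0) rewrite ≺⇒δ≡1 i≺j | δji≡0 = refl
  ... | inj₂ δji≡1 with ≺-or-δ≡1 (≢-sym i≢j)
  ...   | inj₁ j≺i@(_ , δij≡0) rewrite ≺⇒δ≡1 j≺i | δij≡0 = refl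
  ...   | inj₂ δij≡1 = ⊥-elim (¬Tie (i≢j , δij≡1 , δji≡1))

  Tie-free⇒FASFeasible : (∀ {a b} → ¬ Tie a b) → FASFeasible δ
  Tie-free⇒FASFeasible ¬Tie =
    (λ _ _ → δ-binary) ,
    (λ _ _ → δ-complementary ¬Tie) ,
    (λ i j k i≢j j≢k i≢k → c3 i j j k k i i≢j j≢k (≢-sym i≢k) P-refl P-refl P-refl)

lemma2 : (n : ℕ) (P : Fin n → Fin n → Set) →
    IsPartialOrder _≡_ P → Decidable P →
    (δ : Vector n) → MinimalCOV P δ → ¬ FASFeasible δ → TNonempty δ
lemma2 n P po dec δ (feasible , minimal) ¬FAS =
  decidable-stable (TNonempty? δ) λ ¬T →
    ¬FAS (Tie-free⇒FASFeasible (WithoutBasicTriples.¬Tie ¬T minimal))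
  where open Covering po dec feasible
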